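{- Let $q$ be a prime power, $k\geq 2$ an integer and $r$ the smallest even integer $>2\log_q(k+1)$. Put $l=q^{r/2}$, $M_i=l^i(l^2-l)$, $g_i=(l^{\frac{i+1}{2}}-1)^2$ for odd $i$ and $g_i=(l^{\frac{i}{2}}-1)(l^{\frac{i+2}{2}}-1)$ for even $i$, $\Delta_{q,k,i}=M_i-kg_i+k$, $\Theta_{q,k,i}=\{n\in\mathbb{N}\mid \Delta_{q,k,i}>kn\}$, $\phi_{q,i}=\{n\in\mathbb{N}\mid 2g_i+1\leq l^{\frac{n-1}{r}}(l^{\frac1r}-1)\}$, and $I_{q,k,i}=\Theta_{q,k,i}\cap\phi_{q,i}$. Then for every $i\geq 1$, $I_{q,k,i}$ is non-empty.
   Context: $g_i$ is the genus of the $i$-th step of the Garcia–Stichtenoth tower over $\mathbb{F}_{l^2}$ given by $x_{i+1}^l+x_{i+1}=x_i^l/(x_i^{l-1}+1)$; $I_{q,k,i}$ is called the action domain of the $i$-th step (of the descent of this tower to $\mathbb{F}_q$). -}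

module Defs where

open import Data.Nat using (ℕ; zero; suc; _+_; _*_; _∸_; _^_; _≤_; _<_)
open import Data.Nat.DivMod using (_/_; _%_)
open import Data.Nat.Primality using (Prime)
open import Data.Product using (Σ; _×_)
open import Data.Integer as ℤ using (ℤ; +_)
open import Relation.Binary.PropositionalEquality using (_≡_)
open import Relation.Nullary using (¬_)

IsPrimePower : ℕ → Set
IsPrimePower q = Σ ℕ λ p → Σ ℕ λ m → Prime p × 1 ≤ m × q ≡ p ^ m

Even : ℕ → Set
Even n = n % 2 ≡ 0

-- r is the smallest even integer with r > 2 log_q (k+1),
-- i.e. (for q ≥ 2, r ≥ 0) the smallest even r with (k+1)^2 < q^r.
IsSmallestEvenAbove2Log : ℕ → ℕ → ℕ → Set
IsSmallestEvenAbove2Log q k r =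
  Even r × (suc k) ^ 2 < q ^ r ×
  (∀ r′ → Even r′ → (suc k) ^ 2 < q ^ r′ → r ≤ r′)

M : ℕ → ℕ → ℕ
M l i = l ^ i * (l ^ 2 ∸ l)

genus : ℕ → ℕ → ℕ
genus l i with i % 2
... | zero  = (l ^ (i / 2) ∸ 1) * (l ^ ((i + 2) / 2) ∸ 1)
... | suc _ = (l ^ ((i + 1) / 2) ∸ 1) ^ 2

Δ : ℕ → ℕ → ℕ → ℤ
Δ l k i = (+ M l i ℤ.- + (k * genus l i)) ℤ.+ + k

InΘ : ℕ → ℕ → ℕ → ℕ → Set
InΘ l k i n = + (k * n) ℤ.< Δ l k i

-- SqrtCond q a n  expresses the real inequality
--     a ≤ √q^(n-1) (√q - 1)        (a, n ∈ ℕ, q ≥ 1)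
-- exactly in integer arithmetic.  Multiplying by √q > 0 it reads
-- a√q + √q^n ≤ √q^(n+1); writing n = 2m (resp. n = 2m+1) and squaring
-- nonnegative quantities gives:
--   n = 2m   :  q^(2m) ≤ (q^m ∸ a)^2 * q     (false automatically if a ≥ q^m)
--   n = 2m+1 :  (a + q^m)^2 * q ≤ q^(2m+2)
SqrtCond : ℕ → ℕ → ℕ → Set
SqrtCond q a n with n % 2
... | zero  = q ^ (2 * (n / 2)) ≤ (q ^ (n / 2) ∸ a) ^ 2 * q
... | suc _ = (a + q ^ (n / 2)) ^ 2 * q ≤ q ^ (2 * (n / 2) + 2)

-- n ∈ φ_{q,i}  iff  2 g_i + 1 ≤ l^((n-1)/r) (l^(1/r) - 1),
-- where l = q^(r/2), so l^(1/r) = √q and the RHS is √q^(n-1) (√q - 1).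
InΦ : ℕ → ℕ → ℕ → ℕ → Set
InΦ q l i n = SqrtCond q (2 * genus l i + 1) n

InI : ℕ → ℕ → ℕ → ℕ → ℕ → Set
InI q l k i n = InΘ l k i n × InΦ q l i n

{-# OPTIONS --safe #-}
module Submission where

-- Write l = q ^ h and take n = 2 (h (i + 1) + 3), so that √q ^ n = l ^ (i + 1) q³.
-- Since 2 g_i + 1 ≤ 2 l ^ (i + 1), the condition n ∈ φ reduces to c² ≤ 2 (c − 2)²
-- for c = q³ ≥ 8.  On the other side l ≥ 2 ^ h and l ≥ 4 force n ≤ l ^ i + 2 l + 2,
-- and together with g_i ≤ l ^ (i + 1) − 2 l + 1 and k ≤ l − 2 (from (k + 1)² < l²)
-- this gives k n < Δ, i.e. n ∈ Θ.

open import Defs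
open import Data.Nat
open import Data.Nat.Properties
open import Data.Nat.DivMod using (_/_; _%_; m*n%n≡0; m*n/n≡m; [m+kn]%n≡m%n; m≡m%n+[m/n]*n)
open import Data.Nat.Primality using (prime⇒nonZero; prime⇒nonTrivial)
open import Data.Nat.Tactic.RingSolver using (solve-∀)
import Data.Integer as ℤ
import Data.Integer.Properties as ℤ
open import Data.Product using (Σ; _,_)
open import Relation.Binary.PropositionalEquality

2*[2+n]≤2^[2+n] : ∀ n → 2 * (2 + n) ≤ 2 ^ (2 + n)
2*[2+n]≤2^[2+n] zero    = ≤-refl
2*[2+n]≤2^[2+n] (suc n) = begin
  2 * (3 + n)                 ≡⟨ *-distribˡ-+ 2 1 (2 + n) ⟩
  2 + 2 * (2 + n)             ≤⟨ +-mono-≤ (≤-trans (s≤s (s≤s z≤n)) ih) ih ⟩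
  2 ^ (2 + n) + 2 ^ (2 + n)   ≡⟨ cong ((2 ^ (2 + n)) +_) (sym (+-identityʳ _)) ⟩
  2 ^ (3 + n)                 ∎
  where
  open ≤-Reasoning
  ih : 2 * (2 + n) ≤ 2 ^ (2 + n)
  ih = 2*[2+n]≤2^[2+n] n

2*n≤m^n : ∀ {m} n → 2 ≤ m → 4 ≤ m ^ n → 2 * n ≤ m ^ n
2*n≤m^n zero          _   _   = z≤n
2*n≤m^n (suc zero)    _   4≤m = ≤-trans (s≤s (s≤s z≤n)) 4≤m
2*n≤m^n (suc (suc n)) 2≤m _   = ≤-trans (2*[2+n]≤2^[2+n] n) (^-monoˡ-≤ (2 + n) 2≤m)

m≤m^[1+n] : ∀ {m} n → 1 ≤ m → m ≤ m ^ suc n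
m≤m^[1+n] {m@(suc _)} n _ = m≤m*n m (m ^ n) {{m^n≢0 m n}}

n*m≤m^n : ∀ {m} n → 2 ≤ m → n * m ≤ m ^ n
n*m≤m^n {m} zero          _   = z≤n
n*m≤m^n {m} (suc zero)    _   = ≤-reflexive (trans (+-identityʳ m) (sym (*-identityʳ m)))
n*m≤m^n {m} (suc (suc n)) 2≤m = begin
  m + suc n * m         ≤⟨ +-mono-≤ (m≤m^[1+n] n 1≤m) (n*m≤m^n (suc n) 2≤m) ⟩
  m ^ suc n + m ^ suc n ≡⟨ cong ((m ^ suc n) +_) (sym (+-identityʳ _)) ⟩
  2 * m ^ suc n         ≤⟨ *-monoˡ-≤ (m ^ suc n) 2≤m ⟩
  m ^ suc (suc n)       ∎
  where
  open ≤-Reasoning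
  1≤m : 1 ≤ m
  1≤m = ≤-trans (s≤s z≤n) 2≤m

[m∸1]*[n∸1]+2*o≤m*n+1 : ∀ {m n o} → o ≤ m → o ≤ n →
  (m ∸ 1) * (n ∸ 1) + 2 * o ≤ m * n + 1
[m∸1]*[n∸1]+2*o≤m*n+1 {zero}  z≤n _   = z≤n
[m∸1]*[n∸1]+2*o≤m*n+1 {suc m} {zero}  _ z≤n rewrite *-zeroʳ m = z≤n
[m∸1]*[n∸1]+2*o≤m*n+1 {suc m} {suc n} {o} o≤m o≤n = begin
  m * n + 2 * o                 ≤⟨ +-monoʳ-≤ (m * n) (+-mono-≤ o≤m (+-monoˡ-≤ 0 o≤n)) ⟩
  m * n + (suc m + (suc n + 0)) ≡⟨ expand m n ⟩
  suc m * suc n + 1             ∎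
  where
  open ≤-Reasoning
  expand : ∀ m n → m * n + (suc m + (suc n + 0)) ≡ suc m * suc n + 1
  expand = solve-∀

data ParityView : ℕ → Set where
  even : ∀ j → ParityView (j * 2)
  odd  : ∀ j → ParityView (1 + j * 2)

parityView : ∀ n → ParityView n
parityView zero    = even 0
parityView (suc n) with parityView n
... | even j = odd j
... | odd j  = even (suc j)

genus-even : ∀ l j → genus l (j * 2) ≡ (l ^ j ∸ 1) * (l ^ suc j ∸ 1)
genus-even l j
  rewrite m*n%n≡0 j 2 {{_}}
        | m*n/n≡m j 2 {{_}}
        | +-comm (j * 2) 2
        | m*n/n≡m (suc j) 2 {{_}}
        = refl

genus-odd : ∀ l j → genus l (1 + j * 2) ≡ (l ^ suc j ∸ 1) * (l ^ suc j ∸ 1)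
genus-odd l j
  rewrite [m+kn]%n≡m%n 1 j 2 {{_}}
        | trans (cong (_/ 2) (+-comm (1 + j * 2) 1)) (m*n/n≡m (suc j) 2)
        = cong ((l ^ suc j ∸ 1) *_) (*-identityʳ _)

[m^a∸1]*[m^b∸1]+2*m≤m^[a+b]+1 : ∀ {m} a b → 1 ≤ m → 1 ≤ a → 1 ≤ b →
  (m ^ a ∸ 1) * (m ^ b ∸ 1) + 2 * m ≤ m ^ (a + b) + 1
[m^a∸1]*[m^b∸1]+2*m≤m^[a+b]+1 {m} (suc a) (suc b) 1≤m _ _ =
  subst (λ x → (m ^ suc a ∸ 1) * (m ^ suc b ∸ 1) + 2 * m ≤ x + 1)
    (sym (^-distribˡ-+-* m (suc a) (suc b)))
    ([m∸1]*[n∸1]+2*o≤m*n+1 (m≤m^[1+n] a 1≤m) (m≤m^[1+n] b 1≤m))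

genus+2*l≤l^[1+i]+1 : ∀ l i → 1 ≤ l → 1 ≤ i → genus l i + 2 * l ≤ l ^ suc i + 1
genus+2*l≤l^[1+i]+1 l i 1≤l 1≤i with parityView i
... | even (suc j) =
  subst₂ (λ g e → g + 2 * l ≤ l ^ e + 1) (sym (genus-even l (suc j))) (exponent j)
  ([m^a∸1]*[m^b∸1]+2*m≤m^[a+b]+1 (suc j) (2 + j) 1≤l (s≤s z≤n) (s≤s z≤n))
  where
  exponent : ∀ j → suc j + suc (suc j) ≡ suc (suc j * 2)
  exponent = solve-∀
... | odd j =
  subst₂ (λ g e → g + 2 * l ≤ l ^ e + 1) (sym (genus-odd l j)) (exponent j)
  ([m^a∸1]*[m^b∸1]+2*m≤m^[a+b]+1 (suc j) (suc j) 1≤l (s≤s z≤n) (s≤s z≤n))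
  where
  exponent : ∀ j → suc j + suc j ≡ suc (1 + j * 2)
  exponent = solve-∀

2*genus+1≤2*l^[1+i] : ∀ l i → 1 ≤ l → 1 ≤ i → 2 * genus l i + 1 ≤ 2 * l ^ suc i
2*genus+1≤2*l^[1+i] l i 1≤l 1≤i =
  ≤-trans (n≤1+n _) (subst (_≤ 2 * l ^ suc i) (double g) (*-monoʳ-≤ 2 g+1≤l^[1+i]))
  where
  g = genus l i
  g+1≤l^[1+i] : g + 1 ≤ l ^ suc i
  g+1≤l^[1+i] = +-cancelʳ-≤ 1 (g + 1) (l ^ suc i)
    (subst (_≤ l ^ suc i + 1) (sym (+-assoc g 1 1))
      (≤-trans (+-monoʳ-≤ g (*-monoʳ-≤ 2 1≤l)) (genus+2*l≤l^[1+i]+1 l i 1≤l 1≤i)))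
  double : ∀ g → 2 * (g + 1) ≡ suc (2 * g + 1)
  double = solve-∀

+a<+c-+b++d : ∀ {a b c d} → a + b < c + d → ℤ.+ a ℤ.< (ℤ.+ c ℤ.- ℤ.+ b) ℤ.+ ℤ.+ d
+a<+c-+b++d {a} {b} {c} {d} a+b<c+d =
  subst (ℤ.+ a ℤ.<_) (sym +c-+b++d≡+[c+d∸b]) (ℤ.+<+ (m+n≤o⇒m≤o∸n (suc a) a+b<c+d))
  where
  +c-+b++d≡+[c+d∸b] : (ℤ.+ c ℤ.- ℤ.+ b) ℤ.+ ℤ.+ d ≡ ℤ.+ (c + d ∸ b)
  +c-+b++d≡+[c+d∸b] = begin
    (ℤ.+ c ℤ.- ℤ.+ b) ℤ.+ ℤ.+ d ≡⟨ cong (ℤ._+ ℤ.+ d) (ℤ.m-n≡m⊖n c b) ⟩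
    (c ℤ.⊖ b) ℤ.+ ℤ.+ d         ≡⟨ ℤ.distribˡ-⊖-+-pos d c b ⟩
    (c + d) ℤ.⊖ b               ≡⟨ ℤ.⊖-≥ (≤-trans (m≤n+m b a) (<⇒≤ a+b<c+d)) ⟩
    ℤ.+ (c + d ∸ b)             ∎
    where open ≡-Reasoning

m^2∸m≡m*[m∸1] : ∀ m → m ^ 2 ∸ m ≡ m * (m ∸ 1)
m^2∸m≡m*[m∸1] m = begin
  m * (m * 1) ∸ m     ≡⟨ cong (λ x → m * x ∸ m) (*-identityʳ m) ⟩
  m * m ∸ m           ≡⟨ cong (m * m ∸_) (sym (*-identityʳ m)) ⟩
  m * m ∸ m * 1       ≡⟨ sym (*-distribˡ-∸ m m 1) ⟩
  m * (m ∸ 1)         ∎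
  where open ≡-Reasoning

k*[P+l*P+2]<P*[l^2∸l] : ∀ {k l P} → suc k < l → l ≤ P →
  k * (P + l * P + 2) < P * (l ^ 2 ∸ l)
k*[P+l*P+2]<P*[l^2∸l] {k} {l} {P} k<l l≤P
  with m≤n⇒∃[o]m+o≡n k<l | m≤n⇒∃[o]m+o≡n l≤P
... | t , refl | s , refl rewrite m^2∸m≡m*[m∸1] l =
  subst (suc (k * (P + l * P + 2)) ≤_) (slack k t s) (m≤m+n _ _)
  where
  slack : ∀ k t s → let l = 2 + k + t; P = l + s in
    suc (k * (P + l * P + 2)) + (3 + 2 * t + 2 * s + P * (3 * t + k * t + t * t))
      ≡ P * (l * (1 + k + t))
  slack = solve-∀

n∈Θ : ∀ {l k i} n → suc k < l → 1 ≤ i → n ≤ l ^ i + 2 * l + 2 → InΘ l k i n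
n∈Θ {l} {k} {i} n k<l 1≤i n≤ = +a<+c-+b++d (begin-strict
  k * n + k * g               ≡⟨ sym (*-distribˡ-+ k n g) ⟩
  k * (n + g)                 ≤⟨ *-monoʳ-≤ k n+g≤ ⟩
  k * (P + l * P + 2 + 1)     ≡⟨ *-distribˡ-+ k (P + l * P + 2) 1 ⟩
  k * (P + l * P + 2) + k * 1 ≡⟨ cong (k * (P + l * P + 2) +_) (*-identityʳ k) ⟩
  k * (P + l * P + 2) + k     <⟨ +-monoˡ-< k (k*[P+l*P+2]<P*[l^2∸l] k<l l≤P) ⟩
  M l i + k                   ∎)
  where
  open ≤-Reasoning
  g = genus l i
  P = l ^ i
  1≤l : 1 ≤ l
  1≤l = ≤-trans (s≤s z≤n) k<l
  l≤P : l ≤ P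
  l≤P = subst (λ e → l ≤ l ^ e) (m+[n∸m]≡n 1≤i) (m≤m^[1+n] (i ∸ 1) 1≤l)
  n+g≤ : n + g ≤ P + l * P + 2 + 1
  n+g≤ = +-cancelʳ-≤ (2 * l) (n + g) (P + l * P + 2 + 1)
    (subst₂ _≤_ (sym (+-assoc n g (2 * l))) (regroup P (l * P) l)
      (+-mono-≤ n≤ (genus+2*l≤l^[1+i]+1 l i 1≤l 1≤i)))
    where
    regroup : ∀ P Q l → P + 2 * l + 2 + (Q + 1) ≡ P + Q + 2 + 1 + 2 * l
    regroup = solve-∀

m*m≤2*[m∸2]*[m∸2] : ∀ {m} → 7 ≤ m → m * m ≤ 2 * ((m ∸ 2) * (m ∸ 2))
m*m≤2*[m∸2]*[m∸2] 7≤m with m≤n⇒∃[o]m+o≡n 7≤m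
... | w , refl = subst ((7 + w) * (7 + w) ≤_) (expand w) (m≤m+n _ (1 + 6 * w + w * w))
  where
  expand : ∀ w → (7 + w) * (7 + w) + (1 + 6 * w + w * w) ≡ 2 * ((5 + w) * (5 + w))
  expand = solve-∀

SqrtCond-even : ∀ {q a Q c} m → 2 ≤ q → 7 ≤ c → q ^ m ≡ Q * c → a ≤ 2 * Q →
  SqrtCond q a (m * 2)
SqrtCond-even {q} {a} {Q} {c} m 2≤q 7≤c q^m≡Q*c a≤2Q
  rewrite m*n%n≡0 m 2 {{_}} | m*n/n≡m m 2 {{_}} = begin
  q ^ (2 * m)                       ≡⟨ cong (q ^_) (*-comm 2 m) ⟩
  q ^ (m * 2)                       ≡⟨ sym (^-*-assoc q m 2) ⟩
  (q ^ m) ^ 2                       ≡⟨ cong (_^ 2) q^m≡Q*c ⟩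
  (Q * c) ^ 2                       ≡⟨ square-* Q c ⟩
  Q * Q * (c * c)                   ≤⟨ *-monoʳ-≤ (Q * Q) (m*m≤2*[m∸2]*[m∸2] 7≤c) ⟩
  Q * Q * (2 * ((c ∸ 2) * (c ∸ 2))) ≡⟨ regroup Q (c ∸ 2) ⟩
  2 * (Q * (c ∸ 2) * (Q * (c ∸ 2))) ≤⟨ *-mono-≤ 2≤q (*-mono-≤ Q[c∸2]≤Qc∸a Q[c∸2]≤Qc∸a) ⟩
  q * ((Q * c ∸ a) * (Q * c ∸ a))   ≡⟨ cong (λ x → q * ((x ∸ a) * (x ∸ a))) (sym q^m≡Q*c) ⟩
  q * ((q ^ m ∸ a) * (q ^ m ∸ a))   ≡⟨ square-comm q (q ^ m ∸ a) ⟩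
  (q ^ m ∸ a) ^ 2 * q               ∎
  where
  open ≤-Reasoning
  square-* : ∀ x y → x * y * (x * y * 1) ≡ x * x * (y * y)
  square-* = solve-∀
  regroup : ∀ x y → x * x * (2 * (y * y)) ≡ 2 * (x * y * (x * y))
  regroup = solve-∀
  square-comm : ∀ x y → x * (y * y) ≡ y * (y * 1) * x
  square-comm = solve-∀
  Q[c∸2]≤Qc∸a : Q * (c ∸ 2) ≤ Q * c ∸ a
  Q[c∸2]≤Qc∸a = subst (_≤ Q * c ∸ a) (sym (*-distribˡ-∸ Q c 2))
    (∸-monoʳ-≤ (Q * c) (subst (a ≤_) (*-comm 2 Q) a≤2Q))

[h*[1+i]+3]*2∈Φ : ∀ {q l} h i → 2 ≤ q → l ≡ q ^ h → 1 ≤ l → 1 ≤ i →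
  InΦ q l i ((h * suc i + 3) * 2)
[h*[1+i]+3]*2∈Φ {q} h i 2≤q refl 1≤l 1≤i =
  SqrtCond-even {Q = (q ^ h) ^ suc i} (h * suc i + 3) 2≤q 7≤q^3 q^[h*[1+i]+3]≡l^[1+i]*q^3
    (2*genus+1≤2*l^[1+i] (q ^ h) i 1≤l 1≤i)
  where
  7≤q^3 : 7 ≤ q ^ 3
  7≤q^3 = ≤-trans (n≤1+n 7) (^-monoˡ-≤ 3 2≤q)
  q^[h*[1+i]+3]≡l^[1+i]*q^3 : q ^ (h * suc i + 3) ≡ (q ^ h) ^ suc i * q ^ 3
  q^[h*[1+i]+3]≡l^[1+i]*q^3 =
    trans (^-distribˡ-+-* q (h * suc i) 3) (cong (_* q ^ 3) (sym (^-*-assoc q h (suc i))))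

[h*[1+i]+3]*2≤l^i+2*l+2 : ∀ {q l} h i → 2 ≤ q → l ≡ q ^ h → 4 ≤ l →
  (h * suc i + 3) * 2 ≤ l ^ i + 2 * l + 2
[h*[1+i]+3]*2≤l^i+2*l+2 {q} {l} h i 2≤q refl 4≤l = begin
  (h * suc i + 3) * 2  ≡⟨ expand h i ⟩
  2 * h * suc i + 6    ≤⟨ +-monoˡ-≤ 6 (*-monoˡ-≤ (suc i) (2*n≤m^n h 2≤q 4≤l)) ⟩
  l * suc i + 6        ≡⟨ regroup l i ⟩
  i * l + l + 6        ≤⟨ +-mono-≤ (+-monoˡ-≤ l (n*m≤m^n i 2≤l)) (+-monoˡ-≤ 2 4≤l) ⟩
  l ^ i + l + (l + 2)  ≡⟨ collect (l ^ i) l ⟩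
  l ^ i + 2 * l + 2    ∎
  where
  open ≤-Reasoning
  2≤l : 2 ≤ l
  2≤l = ≤-trans (s≤s (s≤s z≤n)) 4≤l
  expand : ∀ h i → (h * suc i + 3) * 2 ≡ 2 * h * suc i + 6
  expand = solve-∀
  regroup : ∀ l i → l * suc i + 6 ≡ i * l + l + 6
  regroup = solve-∀
  collect : ∀ x l → x + l + (l + 2) ≡ x + 2 * l + 2
  collect = solve-∀

IsPrimePower⇒2≤ : ∀ {q} → IsPrimePower q → 2 ≤ q
IsPrimePower⇒2≤ (p , m , p-prime , 1≤m , refl) =
  ≤-trans (nonTrivial⇒n>1 p {{prime⇒nonTrivial p-prime}})
    (subst (_≤ p ^ m) (*-identityʳ p) (^-monoʳ-≤ p {{prime⇒nonZero p-prime}} 1≤m))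

1+k<q^[r/2] : ∀ {q k r} → IsSmallestEvenAbove2Log q k r → suc k < q ^ (r / 2)
1+k<q^[r/2] {q} {k} {r} (r-even , [1+k]^2<q^r , _) =
  ≰⇒> λ l≤1+k → <⇒≱ (subst (suc k ^ 2 <_) q^r≡l^2 [1+k]^2<q^r) (^-monoˡ-≤ 2 l≤1+k)
  where
  l = q ^ (r / 2)
  q^r≡l^2 : q ^ r ≡ l ^ 2
  q^r≡l^2 = begin
    q ^ r                   ≡⟨ cong (q ^_) (m≡m%n+[m/n]*n r 2) ⟩
    q ^ (r % 2 + r / 2 * 2) ≡⟨ cong (λ e → q ^ (e + r / 2 * 2)) r-even ⟩
    q ^ (r / 2 * 2)         ≡⟨ sym (^-*-assoc q (r / 2) 2) ⟩
    l ^ 2                   ∎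
    where open ≡-Reasoning

proposition2 : (q k r l : ℕ) → IsPrimePower q → 2 ≤ k →
    IsSmallestEvenAbove2Log q k r → l ≡ q ^ (r / 2) →
    (i : ℕ) → 1 ≤ i → Σ ℕ λ n → InI q l k i n
proposition2 q k r l q-prime-power 2≤k r-smallest l≡q^h i 1≤i =
  n , n∈Θ n 1+k<l 1≤i ([h*[1+i]+3]*2≤l^i+2*l+2 h i 2≤q l≡q^h 4≤l)
    , [h*[1+i]+3]*2∈Φ h i 2≤q l≡q^h 1≤l 1≤i
  where
  h = r / 2
  n = (h * suc i + 3) * 2
  2≤q : 2 ≤ q
  2≤q = IsPrimePower⇒2≤ q-prime-power
  1+k<l : suc k < l
  1+k<l = subst (suc k <_) (sym l≡q^h) (1+k<q^[r/2] r-smallest)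
  4≤l : 4 ≤ l
  4≤l = ≤-trans (s≤s (s≤s 2≤k)) 1+k<l
  1≤l : 1 ≤ l
  1≤l = ≤-trans (s≤s z≤n) 4≤l
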